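{- Let $k_*\in\{1,2,\dots,\frac{\ell mn}{L}\}$. If $(u_x,v_y,w_z)$ is any row of $A^{(k_*)}$ other than its first row, then $(u_x,v_y,w_z)\neq s_k$ for every $k\in\{1,2,\dots,\frac{\ell mn}{L}\}$.
   Context: Let $\ell,m,n\geq 2$ be integers, $L=\mathrm{lcm}(\ell,m,n)$ and $\lambda=\frac{n\cdot\mathrm{lcm}(\ell,m)}{L}$. Write $V(K_\ell)=\{u_1,\dots,u_\ell\}$, $V(K_m)=\{v_1,\dots,v_m\}$, $V(K_n)=\{w_1,\dots,w_n\}$, so vertices of $K_\ell\square K_m\square K_n$ are triples $(u_a,v_b,w_c)$. Let $\rho=(u_1\,u_2\,\cdots\,u_\ell)$, $\sigma=(v_1\,v_2\,\cdots\,v_m)$, $\tau=(w_1\,w_2\,\cdots\,w_n)$ be the cyclic permutations of the respective vertex sets. Define $L\times 3$ matrices $A^{(k)}=[\mathbf{c}^{(k)}\ \mathbf{d}^{(k)}\ \mathbf{e}^{(k)}]$ (columns) for $k=1,\dots,\frac{\ell mn}{L}$ as follows: row $r$ ($r=1,\dots,L$) of $A^{(1)}$ is $(\rho^{r-1}(u_1),\sigma^{r-1}(v_1),\tau^{r-1}(w_1))$; for $k>1$, $\mathbf{c}^{(k)}=\mathbf{c}^{(1)}$, and if $k\equiv 1\pmod{\lambda}$ then $\mathbf{d}^{(k)}=\sigma(\mathbf{d}^{(k-1)})$, $\mathbf{e}^{(k)}=\mathbf{e}^{(k-1)}$, while otherwise $\mathbf{d}^{(k)}=\mathbf{d}^{(k-1)}$,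 $\mathbf{e}^{(k)}=\tau(\mathbf{e}^{(k-1)})$ (permutations applied entrywise). Each row is regarded as a vertex of $K_\ell\square K_m\square K_n$. The seed $s_k$ is the first row of $A^{(k)}$. -}

module Defs where

open import Data.Nat using (ℕ; zero; suc; _+_; _*_; NonZero; ≢-nonZero; _≡ᵇ_)
open import Data.Nat.Properties using (m*n≢0)
open import Data.Nat.LCM using (lcm; lcm-least)
open import Data.Nat.Divisibility using (_∣_; m∣m*n; n∣m*n; 0∣⇒≡0)
open import Data.Nat.DivMod using (_mod_; _%_; _/_)
open import Data.Fin using (Fin; toℕ)
open import Data.Bool using (Bool; true; false; if_then_else_)
open import Data.Empty using (⊥)
open import Data.Product using (_×_; _,_)
open import Function using (_∘_)
open import Relation.Binary.PropositionalEquality using (_≡_; subst)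

-- Vertex sets: u_{a+1} ↦ a : Fin ℓ (0-indexed), similarly for v, w.
-- Vertices of K_ℓ □ K_m □ K_n are triples.
Vertex : ℕ → ℕ → ℕ → Set
Vertex ℓ m n = Fin ℓ × Fin m × Fin n

cyc : (p : ℕ) .{{_ : NonZero p}} → Fin p → Fin p
cyc p x = (suc (toℕ x)) mod p

iter : {A : Set} → (A → A) → ℕ → A → A
iter f zero    x = x
iter f (suc r) x = f (iter f r x)

lcm-nonZero : (a b : ℕ) .{{_ : NonZero a}} .{{_ : NonZero b}} → NonZero (lcm a b)
lcm-nonZero a b = ≢-nonZero λ eq →
  let inst = m*n≢0 a b
      d : lcm a b ∣ a * b
      d = lcm-least {a} {b} (m∣m*n b) (n∣m*n a)
      z : a * b ≡ 0
      z = 0∣⇒≡0 (subst (_∣ a * b) eq d)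
  in nz (a * b) {{inst}} z
  where
  nz : ∀ x .{{_ : NonZero x}} → x ≡ 0 → ⊥
  nz (suc x) ()

module Construction (ℓ m n : ℕ) .{{_ : NonZero ℓ}} .{{_ : NonZero m}} .{{_ : NonZero n}} where

  instance
    lm-nz : NonZero (lcm ℓ m)
    lm-nz = lcm-nonZero ℓ m
    L-nz : NonZero (lcm (lcm ℓ m) n)
    L-nz = lcm-nonZero (lcm ℓ m) n

  L : ℕ
  L = lcm (lcm ℓ m) n

  lam : ℕ
  lam = (n * lcm ℓ m) / L

  K : ℕ
  K = (ℓ * m * n) / L

  ρ : Fin ℓ → Fin ℓ
  ρ = cyc ℓ
  σ : Fin m → Fin m
  σ = cyc m
  τ : Fin n → Fin n
  τ = cyc n

  u₁ : Fin ℓ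
  u₁ = 0 mod ℓ
  v₁ : Fin m
  v₁ = 0 mod m
  w₁ : Fin n
  w₁ = 0 mod n

  -- columns as functions of the row index r ∈ {1,…,L} (values outside the
  -- range are irrelevant).
  Col : Set → Set
  Col A = ℕ → A

  c¹ : Col (Fin ℓ)
  c¹ r = iter ρ (r Data.Nat.∸ 1) u₁
  d¹ : Col (Fin m)
  d¹ r = iter σ (r Data.Nat.∸ 1) v₁
  e¹ : Col (Fin n)
  e¹ r = iter τ (r Data.Nat.∸ 1) w₁

  -- columns (d^(k), e^(k)) for k ≥ 1 (k = 0 is a dummy, equal to k = 1)
  de : ℕ → Col (Fin m) × Col (Fin n)
  de zero = d¹ , e¹
  de (suc zero) = d¹ , e¹
  de (suc (suc j)) with de (suc j)
  ... | d , e =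
    if lamTest (suc (suc j)) then (σ ∘ d , e) else (d , τ ∘ e)
    where
    -- k ≡ 1 (mod λ); λ ≥ 1 always holds, the λ = 0 branch is a dummy
    lamTest : ℕ → Bool
    lamTest k with lam
    ... | zero = false
    ... | suc p = (k % suc p) ≡ᵇ (1 % suc p)

  row : (k r : ℕ) → Vertex ℓ m n
  row k r with de k
  ... | d , e = c¹ r , d r , e r

  seed : ℕ → Vertex ℓ m n
  seed k = row k 1

-- With t = r − 1, row r of A^(k) is (ρ^t u₁, σ^(a+t) v₁, τ^(b+t) w₁), where a = ⌊(k−1)/λ⌋
-- and b = k − 1 − a count the σ- and τ-steps, and λ = gcd(lcm(ℓ,m), n). If it equals the seed
-- (u₁, σ^a′ v₁, τ^b′ w₁) of A^(k′), then ℓ ∣ t. Since k, k′ ≤ ℓmn/L = gcd(ℓ,m)·λ, both a and a′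
-- are below gcd(ℓ,m), which divides ℓ and m, so a = a′ and m ∣ t. Then λ divides t and n, so
-- b ≡ b′ (mod λ): k − 1 and k′ − 1 have equal quotient and remainder mod λ, hence k = k′ and
-- n ∣ t. So L ∣ t, which is impossible for 0 < t < L.
module Submission where

open import Defs
open import Data.Nat using (ℕ; NonZero; _≤_; _<_)
open import Relation.Binary.PropositionalEquality using (_≢_)

open import Data.Nat using (zero; suc; _+_; _*_; _∸_; _%_; _/_; _≡ᵇ_; s≤s; ≢-nonZero; ≢-nonZero⁻¹)
open import Data.Nat.Properties
open import Data.Nat.DivMod
open import Data.Nat.Divisibility using (_∣_; _∣?_; divides; ∣-trans; ∣⇒≤; m∣m*n; n∣m*n; m%n≡0⇒n∣m; n∣m⇒m%n≡0)
open import Data.Nat.LCM using (lcm; lcm-least; gcd*lcm)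
open import Data.Nat.GCD using (gcd; gcd[m,n]∣m; gcd[m,n]∣n; gcd[m,n]≢0)
open import Data.Fin using (Fin; toℕ)
open import Data.Fin.Properties using (toℕ-fromℕ<)
open import Data.Bool using (Bool; true; false; if_then_else_)
open import Data.Sum using (inj₂)
open import Data.Product using (_×_; _,_; proj₁; proj₂)
open import Function using (_∘_)
open import Relation.Binary.PropositionalEquality
  using (_≡_; refl; sym; trans; cong; cong₂; subst; module ≡-Reasoning)
open import Relation.Nullary using (¬_; yes; no)
open import Relation.Nullary.Decidable using (dec-true; dec-false)

%-cong-+ : ∀ {a b c d} p .{{_ : NonZero p}} →
           a % p ≡ b % p → c % p ≡ d % p → (a + c) % p ≡ (b + d) % p
%-cong-+ {a} {b} {c} {d} p a≡b c≡d = begin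
  (a + c) % p           ≡⟨ %-distribˡ-+ a c p ⟩
  (a % p + c % p) % p   ≡⟨ cong₂ (λ x y → (x + y) % p) a≡b c≡d ⟩
  (b % p + d % p) % p   ≡⟨ %-distribˡ-+ b d p ⟨
  (b + d) % p           ∎
  where open ≡-Reasoning

-- Adding (p ∸ 1) * a completes a to the multiple p * a.
[m+n]%o≡m%o⇒o∣n : ∀ a t p .{{_ : NonZero p}} → (a + t) % p ≡ a % p → p ∣ t
[m+n]%o≡m%o⇒o∣n a t p@(suc p′) eq = m%n≡0⇒n∣m t p (begin
  t % p                   ≡⟨ %-remove-+ʳ t (m∣m*n a) ⟨
  (t + p * a) % p         ≡⟨ cong (_% p) (+-assoc t a (p′ * a)) ⟨
  (t + a + p′ * a) % p    ≡⟨ %-cong-+ {t + a} {a + t} {p′ * a} p (%-congˡ (+-comm t a)) refl ⟩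
  (a + t + p′ * a) % p    ≡⟨ %-cong-+ {a + t} {a} {p′ * a} p eq refl ⟩
  (a + p′ * a) % p        ≡⟨ n∣m⇒m%n≡0 (p * a) p (m∣m*n a) ⟩
  0                       ∎)
  where open ≡-Reasoning

%-≡-divisor : ∀ {d p} x y .{{_ : NonZero d}} .{{_ : NonZero p}} →
              d ∣ p → x % p ≡ y % p → x % d ≡ y % d
%-≡-divisor {d} {p} x y d∣p eq = begin
  x % d       ≡⟨ m∣n⇒o%n%m≡o%m d p x d∣p ⟨
  x % p % d   ≡⟨ cong (_% d) eq ⟩
  y % p % d   ≡⟨ m∣n⇒o%n%m≡o%m d p y d∣p ⟩
  y % d       ∎
  where open ≡-Reasoning

[m+n]%o≡p%o⇒m%d≡p%d : ∀ {d p} x t y .{{_ : NonZero d}} .{{_ : NonZero p}} →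
                      d ∣ p → d ∣ t → (x + t) % p ≡ y % p → x % d ≡ y % d
[m+n]%o≡p%o⇒m%d≡p%d x t y d∣p d∣t eq =
  trans (sym (%-remove-+ʳ x d∣t)) (%-≡-divisor (x + t) y d∣p eq)

%-injective-< : ∀ {x y p} .{{_ : NonZero p}} → x < p → y < p → x % p ≡ y % p → x ≡ y
%-injective-< x<p y<p eq = trans (sym (m<n⇒m%n≡m x<p)) (trans eq (m<n⇒m%n≡m y<p))

/-%-injective : ∀ {x y} p .{{_ : NonZero p}} → x / p ≡ y / p → x % p ≡ y % p → x ≡ y
/-%-injective {x} {y} p q≡ r≡ = begin
  x                   ≡⟨ m≡m%n+[m/n]*n x p ⟩
  x % p + x / p * p   ≡⟨ cong₂ (λ r q → r + q * p) r≡ q≡ ⟩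
  y % p + y / p * p   ≡⟨ m≡m%n+[m/n]*n y p ⟨
  y                   ∎
  where open ≡-Reasoning

/-unique : ∀ {x r q} p .{{_ : NonZero p}} → r < p → x ≡ r + q * p → x / p ≡ q
/-unique {x} {r} {q} p r<p refl = begin
  (r + q * p) / p     ≡⟨ +-distrib-/-∣ʳ r (n∣m*n q) ⟩
  r / p + q * p / p   ≡⟨ cong₂ _+_ (m<n⇒m/n≡0 r<p) (m*n/n≡m q p) ⟩
  q                   ∎
  where open ≡-Reasoning

/-suc-∣ : ∀ i p .{{_ : NonZero p}} → p ∣ suc i → suc i / p ≡ suc (i / p)
/-suc-∣ i p@(suc p′) (divides (suc q) eq) = begin
  suc i / p         ≡⟨ /-congˡ eq ⟩
  suc q * p / p     ≡⟨ m*n/n≡m (suc q) p ⟩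
  suc q             ≡⟨ cong suc (/-unique p (n<1+n p′) (suc-injective eq)) ⟨
  suc (i / p)       ∎
  where open ≡-Reasoning

/-suc-∤ : ∀ i p .{{_ : NonZero p}} → ¬ p ∣ suc i → suc i / p ≡ i / p
/-suc-∤ i p p∤ = /-unique p (≤∧≢⇒< (m%n<n i p) suc-rem≢p) (cong suc (m≡m%n+[m/n]*n i p))
  where
  suc-rem≢p : suc (i % p) ≢ p
  suc-rem≢p eq = p∤ (divides (suc (i / p)) (begin
    suc i                   ≡⟨ cong suc (m≡m%n+[m/n]*n i p) ⟩
    suc (i % p) + i / p * p ≡⟨ cong (_+ i / p * p) eq ⟩
    suc (i / p) * p         ∎))
    where open ≡-Reasoning

iter-+ : ∀ {A : Set} (f : A → A) a b x → iter f a (iter f b x) ≡ iter f (a + b) x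
iter-+ f zero    b x = refl
iter-+ f (suc a) b x = cong f (iter-+ f a b x)

toℕ-iter-cyc : ∀ p .{{_ : NonZero p}} N → toℕ (iter (cyc p) N (0 mod p)) ≡ N % p
toℕ-iter-cyc p zero    = toℕ-fromℕ< _
toℕ-iter-cyc p (suc N) = begin
  toℕ (cyc p (iter (cyc p) N (0 mod p)))  ≡⟨ toℕ-fromℕ< _ ⟩
  suc (toℕ (iter (cyc p) N (0 mod p))) % p ≡⟨ cong (λ x → suc x % p) (toℕ-iter-cyc p N) ⟩
  (1 + N % p) % p                          ≡⟨ %-cong-+ {1} {1} {N % p} {N} p refl (m%n%n≡m%n N p) ⟩
  suc N % p                                ∎
  where open ≡-Reasoning

-- The test k ≡ 1 (mod λ) local to Construction.de, with λ abstracted to g.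
isBlockStart : ℕ → ℕ → Bool
isBlockStart zero    k = false
isBlockStart (suc p) k = k % suc p ≡ᵇ 1 % suc p

isBlockStart-∣ : ∀ g .{{_ : NonZero g}} i → g ∣ suc i → isBlockStart g (2 + i) ≡ true
isBlockStart-∣ g@(suc _) i g∣ = dec-true ((2 + i) % g ≟ 1 % g) (%-remove-+ʳ 1 g∣)

isBlockStart-∤ : ∀ g .{{_ : NonZero g}} i → ¬ g ∣ suc i → isBlockStart g (2 + i) ≡ false
isBlockStart-∤ g@(suc _) i g∤ = dec-false ((2 + i) % g ≟ 1 % g) (g∤ ∘ [m+n]%o≡m%o⇒o∣n 1 (suc i) g)

-- Number of σ- resp. τ-steps on the way from A^(1) to A^(i+1) (note the shift k = i + 1).
σSteps τSteps : ℕ → ℕ → ℕ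
σSteps g zero    = 0
σSteps g (suc i) = if isBlockStart g (2 + i) then suc (σSteps g i) else σSteps g i
τSteps g zero    = 0
τSteps g (suc i) = if isBlockStart g (2 + i) then τSteps g i else suc (τSteps g i)

σSteps≡/ : ∀ g .{{_ : NonZero g}} i → σSteps g i ≡ i / g
σSteps≡/ g zero = sym (0/n≡0 g)
σSteps≡/ g (suc i) with g ∣? suc i
... | yes g∣ rewrite isBlockStart-∣ g i g∣ = trans (cong suc (σSteps≡/ g i)) (sym (/-suc-∣ i g g∣))
... | no g∤  rewrite isBlockStart-∤ g i g∤ = trans (σSteps≡/ g i) (sym (/-suc-∤ i g g∤))

σSteps+τSteps : ∀ g i → σSteps g i + τSteps g i ≡ i
σSteps+τSteps g zero = refl
σSteps+τSteps g (suc i) with isBlockStart g (2 + i)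
... | true  = cong suc (σSteps+τSteps g i)
... | false = trans (+-suc (σSteps g i) (τSteps g i)) (cong suc (σSteps+τSteps g i))

τSteps≡∸/ : ∀ g .{{_ : NonZero g}} i → τSteps g i ≡ i ∸ i / g
τSteps≡∸/ g i = begin
  τSteps g i                       ≡⟨ m+n∸m≡n (σSteps g i) (τSteps g i) ⟨
  σSteps g i + τSteps g i ∸ σSteps g i ≡⟨ cong₂ _∸_ (σSteps+τSteps g i) (σSteps≡/ g i) ⟩
  i ∸ i / g                        ∎
  where open ≡-Reasoning

-- The σ-counts agree mod D and are < D, hence equal; the τ-counts then agree mod g,
-- so i and j have the same quotient and remainder mod g.
lcm∣shift : ∀ {ℓ m n g D} .{{_ : NonZero ℓ}} .{{_ : NonZero m}} .{{_ : NonZero n}}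
            .{{_ : NonZero g}} .{{_ : NonZero D}} →
            D ∣ ℓ → D ∣ m → g ∣ lcm ℓ m → g ∣ n →
            ∀ {i j t} → i < D * g → j < D * g → ℓ ∣ t →
            (i / g + t) % m ≡ (j / g) % m →
            (i ∸ i / g + t) % n ≡ (j ∸ j / g) % n →
            lcm (lcm ℓ m) n ∣ t
lcm∣shift {ℓ} {m} {n} {g} {D} D∣ℓ D∣m g∣lcm g∣n {i} {j} {t} i< j< ℓ∣t σ≡ τ≡ =
  lcm-least lcm∣t n∣t
  where
  quot≡ : i / g ≡ j / g
  quot≡ = %-injective-< (m<n*o⇒m/o<n i<) (m<n*o⇒m/o<n j<)
                ([m+n]%o≡p%o⇒m%d≡p%d (i / g) t (j / g) D∣m (∣-trans D∣ℓ ℓ∣t) σ≡)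
  m∣t : m ∣ t
  m∣t = [m+n]%o≡m%o⇒o∣n (i / g) t m (trans σ≡ (cong (_% m) (sym quot≡)))
  lcm∣t : lcm ℓ m ∣ t
  lcm∣t = lcm-least ℓ∣t m∣t
  rest≡ : (i ∸ i / g) % g ≡ (j ∸ j / g) % g
  rest≡ = [m+n]%o≡p%o⇒m%d≡p%d (i ∸ i / g) t (j ∸ j / g) g∣n (∣-trans g∣lcm lcm∣t) τ≡
  i≡j : i ≡ j
  i≡j = /-%-injective g quot≡ (begin
    i % g                       ≡⟨ cong (_% g) (m+[n∸m]≡n (m/n≤m i g)) ⟨
    (i / g + (i ∸ i / g)) % g   ≡⟨ %-cong-+ g (cong (_% g) quot≡) rest≡ ⟩
    (j / g + (j ∸ j / g)) % g   ≡⟨ cong (_% g) (m+[n∸m]≡n (m/n≤m j g)) ⟩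
    j % g                       ∎)
    where open ≡-Reasoning
  n∣t : n ∣ t
  n∣t = [m+n]%o≡m%o⇒o∣n (i ∸ i / g) t n
          (subst (λ j → (i ∸ i / g + t) % n ≡ (j ∸ j / g) % n) (sym i≡j) τ≡)

module Properties (ℓ m n : ℕ) .{{_ : NonZero ℓ}} .{{_ : NonZero m}} .{{_ : NonZero n}} where
  open Construction ℓ m n

  lam≡gcd : lam ≡ gcd (lcm ℓ m) n
  lam≡gcd = begin
    n * lcm ℓ m / L                  ≡⟨ cong (_/ L) (*-comm n (lcm ℓ m)) ⟩
    lcm ℓ m * n / L                  ≡⟨ cong (_/ L) (gcd*lcm (lcm ℓ m) n) ⟨
    gcd (lcm ℓ m) n * L / L          ≡⟨ m*n/n≡m (gcd (lcm ℓ m) n) L ⟩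
    gcd (lcm ℓ m) n                  ∎
    where open ≡-Reasoning

  instance
    lam-nonZero : NonZero lam
    lam-nonZero = subst NonZero (sym lam≡gcd)
                    (≢-nonZero (gcd[m,n]≢0 (lcm ℓ m) n (inj₂ (≢-nonZero⁻¹ n))))
    gcd-nonZero : NonZero (gcd ℓ m)
    gcd-nonZero = ≢-nonZero (gcd[m,n]≢0 ℓ m (inj₂ (≢-nonZero⁻¹ m)))

  K≡gcd*lam : K ≡ gcd ℓ m * lam
  K≡gcd*lam = begin
    ℓ * m * n / L                            ≡⟨ cong (_/ L) (cong (_* n) (gcd*lcm ℓ m)) ⟨
    gcd ℓ m * lcm ℓ m * n / L                ≡⟨ cong (_/ L) (*-assoc (gcd ℓ m) (lcm ℓ m) n) ⟩
    gcd ℓ m * (lcm ℓ m * n) / L              ≡⟨ cong (_/ L) (cong (gcd ℓ m *_) (gcd*lcm (lcm ℓ m) n)) ⟨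
    gcd ℓ m * (gcd (lcm ℓ m) n * L) / L      ≡⟨ cong (_/ L) (*-assoc (gcd ℓ m) _ L) ⟨
    gcd ℓ m * gcd (lcm ℓ m) n * L / L        ≡⟨ m*n/n≡m (gcd ℓ m * gcd (lcm ℓ m) n) L ⟩
    gcd ℓ m * gcd (lcm ℓ m) n                ≡⟨ cong (gcd ℓ m *_) lam≡gcd ⟨
    gcd ℓ m * lam                            ∎
    where open ≡-Reasoning

  lam∣lcm : lam ∣ lcm ℓ m
  lam∣lcm = subst (_∣ lcm ℓ m) (sym lam≡gcd) (gcd[m,n]∣m (lcm ℓ m) n)

  lam∣n : lam ∣ n
  lam∣n = subst (_∣ n) (sym lam≡gcd) (gcd[m,n]∣n (lcm ℓ m) n)

  index<gcd*lam : ∀ {i} → suc i ≤ K → i < gcd ℓ m * lam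
  index<gcd*lam = subst (_ ≤_) K≡gcd*lam

  de-step : ∀ i → de (2 + i) ≡
    (if isBlockStart lam (2 + i) then (σ ∘ proj₁ (de (suc i)) , proj₂ (de (suc i)))
                                 else (proj₁ (de (suc i)) , τ ∘ proj₂ (de (suc i))))
  de-step i with lam
  ... | zero  = refl
  ... | suc _ = refl

  de-columns : ∀ i r → proj₁ (de (suc i)) r ≡ iter σ (σSteps lam i) (d¹ r)
                     × proj₂ (de (suc i)) r ≡ iter τ (τSteps lam i) (e¹ r)
  de-columns zero    r = refl , refl
  de-columns (suc i) r rewrite de-step i with isBlockStart lam (2 + i) | de-columns i r
  ... | true  | d≡ , e≡ = cong σ d≡ , e≡
  ... | false | d≡ , e≡ = d≡ , cong τ e≡

  toℕ-row : ∀ i t → toℕ (proj₁ (row (suc i) (suc t))) ≡ t % ℓ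
                  × toℕ (proj₁ (proj₂ (row (suc i) (suc t)))) ≡ (i / lam + t) % m
                  × toℕ (proj₂ (proj₂ (row (suc i) (suc t)))) ≡ (i ∸ i / lam + t) % n
  toℕ-row i t = toℕ-iter-cyc ℓ t
              , column (σSteps≡/ lam i) (proj₁ (de-columns i (suc t)))
              , column (τSteps≡∸/ lam i) (proj₂ (de-columns i (suc t)))
    where
    column : ∀ {p} .{{_ : NonZero p}} {x : Fin p} {a b} → a ≡ b →
             x ≡ iter (cyc p) a (iter (cyc p) t (0 mod p)) → toℕ x ≡ (b + t) % p
    column {p} {x} {a} refl refl = trans (cong toℕ (iter-+ (cyc p) a t _)) (toℕ-iter-cyc p (a + t))

mainTheorem8 : (ℓ m n : ℕ) .{{_ : NonZero ℓ}} .{{_ : NonZero m}} .{{_ : NonZero n}} →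
    2 ≤ ℓ → 2 ≤ m → 2 ≤ n →
    (kₛ : ℕ) → 1 ≤ kₛ → kₛ ≤ Construction.K ℓ m n →
    (r : ℕ) → 2 ≤ r → r ≤ Construction.L ℓ m n →
    (k : ℕ) → 1 ≤ k → k ≤ Construction.K ℓ m n →
    Construction.row ℓ m n kₛ r ≢ Construction.seed ℓ m n k
mainTheorem8 ℓ m n _ _ _ (suc i) _ kₛ≤K (suc (suc t)) _ r≤L (suc j) _ k≤K row≡seed =
  <⇒≱ r≤L (∣⇒≤ (lcm∣shift (gcd[m,n]∣m ℓ m) (gcd[m,n]∣n ℓ m) lam∣lcm lam∣n
                 (index<gcd*lam kₛ≤K) (index<gcd*lam k≤K) ℓ∣t σ≡ τ≡))
  where
  open Construction ℓ m n
  open Properties ℓ m n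
  compare : ∀ {x y} (f : Vertex ℓ m n → ℕ) →
            f (row (suc i) (suc (suc t))) ≡ x → f (seed (suc j)) ≡ y → x ≡ y
  compare f p q = trans (sym p) (trans (cong f row≡seed) q)
  ℓ∣t : ℓ ∣ suc t
  ℓ∣t = [m+n]%o≡m%o⇒o∣n 0 (suc t) ℓ
          (compare (toℕ ∘ proj₁) (proj₁ (toℕ-row i (suc t))) (proj₁ (toℕ-row j 0)))
  σ≡ : (i / lam + suc t) % m ≡ (j / lam) % m
  σ≡ = compare (toℕ ∘ proj₁ ∘ proj₂) (proj₁ (proj₂ (toℕ-row i (suc t))))
         (trans (proj₁ (proj₂ (toℕ-row j 0))) (cong (_% m) (+-identityʳ _)))
  τ≡ : (i ∸ i / lam + suc t) % n ≡ (j ∸ j / lam) % n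
  τ≡ = compare (toℕ ∘ proj₂ ∘ proj₂) (proj₂ (proj₂ (toℕ-row i (suc t))))
         (trans (proj₂ (proj₂ (toℕ-row j 0))) (cong (_% n) (+-identityʳ _)))
mainTheorem8 ℓ m n _ _ _ _ _ _ (suc zero) (s≤s ()) _ _ _ _ _
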